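{- If $f$ is a $(3,4,4)$-face of $G$ and $v$ is its vertex of degree $3$, then the pendant neighbor of $v$ (the neighbor of $v$ not on $f$) has degree at least $4$.
   Context: A $(1,1,0)$-coloring of a graph is an assignment of colors from $\{1,2,3\}$ to its vertices such that every vertex of color $1$ has at most one neighbor of color $1$, every vertex of color $2$ has at most one neighbor of color $2$, and no two adjacent vertices both have color $3$. Throughout, $G$ is a fixed plane graph (planar graph with a fixed embedding) containing no cycle of length $4$ or $5$, which has no $(1,1,0)$-coloring but every proper subgraph of which has a $(1,1,0)$-coloring. A $3$-face is a face bounded by a triangle. A $(3,4,4)$-face is a $3$-face whose vertices have degrees $3,4,4$. -}

module Defs where

open import Data.Nat using (ℕ; zero; suc; _+_; _*_; _≤ᵇ_; _≤_)
open import Data.Bool using (Bool; true; false; _∧_; _∨_; not; if_then_else_)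
open import Data.Fin using (Fin; toℕ) renaming (zero to fz; suc to fs)
open import Data.Fin.Properties using (_≟_)
open import Data.List using (List; []; _∷_; length; filterᵇ; allFin; concatMap; map; upTo)
open import Data.Bool.ListAction using (all; any)
open import Data.List.Membership.Propositional using (_∈_)
open import Data.List.Relation.Unary.Unique.Propositional using (Unique)
open import Data.Product using (Σ; _×_; _,_; proj₁; proj₂)
open import Data.Sum using (_⊎_)
open import Data.Empty using (⊥)
open import Function using (_⇔_)
open import Function.Definitions using (Injective)
open import Relation.Binary.PropositionalEquality using (_≡_; _≢_)
open import Relation.Nullary.Decidable using (⌊_⌋)

iter : {A : Set} → (A → A) → ℕ → A → A
iter f zero a = a
iter f (suc k) a = f (iter f k a)

module _ {n : ℕ} where

  _==_ : Fin n → Fin n → Bool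
  u == v = ⌊ u ≟ v ⌋

  degree : (Fin n → Fin n → Bool) → Fin n → ℕ
  degree adj v = length (filterᵇ (adj v) (allFin n))

  -- Rotation systems (combinatorial embeddings).
  -- rot v lists the neighbours of v in the cyclic (clockwise) order
  -- given by the embedding.  nextIn l u is the successor of u in the
  -- cyclic list l.

  nextIn : List (Fin n) → Fin n → Fin n
  nextIn [] u = u
  nextIn (a ∷ l) u = go a (a ∷ l)
    where
    go : Fin n → List (Fin n) → Fin n
    go first [] = u
    go first (x ∷ []) = if x == u then first else u
    go first (x ∷ y ∷ r) = if x == u then y else go first (y ∷ r)

  Dart : Set
  Dart = Fin n × Fin n

  -- face-tracing permutation on darts: (u , v) ↦ (v , successor of u at v)
  faceStep : (Fin n → List (Fin n)) → Dart → Dart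
  faceStep rot (u , v) = v , nextIn (rot v) u

  code : Dart → ℕ
  code (u , v) = toℕ u * n + toℕ v

  countᵇ : {A : Set} → (A → Bool) → List A → ℕ
  countᵇ p l = length (filterᵇ p l)

  allDarts : List Dart
  allDarts = concatMap (λ u → map (λ v → u , v) (allFin n)) (allFin n)

  isDart : (Fin n → Fin n → Bool) → Dart → Bool
  isDart adj (u , v) = adj u v

  -- number of darts (= twice the number of edges)
  numDarts : (Fin n → Fin n → Bool) → ℕ
  numDarts adj = countᵇ (isDart adj) allDarts

  orbitMin : (Fin n → List (Fin n)) → Dart → Bool
  orbitMin rot d = all (λ k → code d ≤ᵇ code (iter (faceStep rot) k d)) (upTo (n * n))

  isolated : (Fin n → Fin n → Bool) → Fin n → Bool
  isolated adj v = not (any (adj v) (allFin n))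

  -- number of faces of the embedding: face orbits of darts, plus one
  -- face for each isolated vertex (a one-vertex component has one face)
  numFaces : (Fin n → Fin n → Bool) → (Fin n → List (Fin n)) → ℕ
  numFaces adj rot =
    countᵇ (λ d → isDart adj d ∧ orbitMin rot d) allDarts
    + countᵇ (isolated adj) (allFin n)

  reach : (Fin n → Fin n → Bool) → ℕ → Fin n → Fin n → Bool
  reach adj zero v w = v == w
  reach adj (suc k) v w = reach adj k v w ∨ any (λ x → reach adj k v x ∧ adj x w) (allFin n)

  numComponents : (Fin n → Fin n → Bool) → ℕ
  numComponents adj =
    countᵇ (λ v → all (λ w → not (reach adj n v w) ∨ (toℕ v ≤ᵇ toℕ w)) (allFin n)) (allFin n)

-- A plane graph: a finite simple graph together with a rotation system
-- of genus 0 (Euler's formula V - E + F = 2C, written as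
-- 2V + 2F = 2E + 4C with 2E = number of darts).

record PlaneGraph : Set where
  field
    n      : ℕ
    adj    : Fin n → Fin n → Bool
    sym    : ∀ u v → adj u v ≡ adj v u
    irrefl : ∀ v → adj v v ≡ false
    rot    : Fin n → List (Fin n)
    rot-unique   : ∀ v → Unique (rot v)
    rot-complete : ∀ v w → (w ∈ rot v) ⇔ (adj v w ≡ true)
    euler  : 2 * n + 2 * numFaces adj rot ≡ numDarts adj + 4 * numComponents adj

col1 col2 col3 : Fin 3
col1 = fz
col2 = fs fz
col3 = fs (fs fz)

Is110Coloring : {n : ℕ} → (Fin n → Fin n → Bool) → (Fin n → Fin 3) → Set
Is110Coloring {n} E c =
  (∀ v w₁ w₂ → (c v ≡ col1 ⊎ c v ≡ col2) →
     E v w₁ ≡ true → E v w₂ ≡ true → c w₁ ≡ c v → c w₂ ≡ c v → w₁ ≡ w₂)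
  ×
  (∀ v w → E v w ≡ true → c v ≡ col3 → c w ≢ col3)

Has110Coloring : {n : ℕ} → (Fin n → Fin n → Bool) → Set
Has110Coloring {n} E = Σ (Fin n → Fin 3) (Is110Coloring E)

-- A colouring of the subgraph is a colouring of its vertices; vertices
-- outside S carry no constraint, so we colour all of Fin n.

record Subgraph {n : ℕ} (adj : Fin n → Fin n → Bool) : Set where
  field
    S     : Fin n → Bool
    E'    : Fin n → Fin n → Bool
    E'-sym : ∀ u v → E' u v ≡ E' v u
    E'⊆E  : ∀ u v → E' u v ≡ true → adj u v ≡ true
    E'-S  : ∀ u v → E' u v ≡ true → S u ≡ true

IsProper : {n : ℕ} {adj : Fin n → Fin n → Bool} → Subgraph adj → Set
IsProper {n} {adj} H =
  Σ (Fin n) (λ v → Subgraph.S H v ≡ false)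
  ⊎ Σ (Fin n) (λ u → Σ (Fin n) (λ v → adj u v ≡ true × Subgraph.E' H u v ≡ false))

CyclicSucc : {k : ℕ} → Fin k → Fin k → Set
CyclicSucc {k} i j = (suc (toℕ i) ≡ toℕ j) ⊎ (suc (toℕ i) ≡ k × toℕ j ≡ 0)

HasCycleOfLength : {n : ℕ} → (Fin n → Fin n → Bool) → ℕ → Set
HasCycleOfLength {n} adj k =
  Σ (Fin k → Fin n) (λ f → Injective _≡_ _≡_ f ×
     (∀ i j → CyclicSucc i j → adj (f i) (f j) ≡ true))

record MinimalCounterexample (G : PlaneGraph) : Set where
  open PlaneGraph G
  field
    no-C4 : HasCycleOfLength adj 4 → ⊥
    no-C5 : HasCycleOfLength adj 5 → ⊥
    not-colorable : Has110Coloring adj → ⊥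
    proper-colorable : (H : Subgraph adj) → IsProper H → Has110Coloring (Subgraph.E' H)

-- A 3-face containing the dart (v , u): the face orbit of (v , u) has
-- length 3, i.e. its boundary walk is the triangle v u w.
IsTriangularFaceDart : (G : PlaneGraph) → Fin (PlaneGraph.n G) → Fin (PlaneGraph.n G) → Set
IsTriangularFaceDart G v u =
  adj v u ≡ true × iter (faceStep rot) 3 (v , u) ≡ (v , u)
  where open PlaneGraph G

thirdVertex : (G : PlaneGraph) → Fin (PlaneGraph.n G) → Fin (PlaneGraph.n G) → Fin (PlaneGraph.n G)
thirdVertex G v u = proj₂ (faceStep (PlaneGraph.rot G) (v , u))

module Submission where

-- Suppose deg x ≤ 3.  By minimality G − v has a (1,1,0)-colouring c, and
-- we extend it to G, contradicting that G is not colourable.  If some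
-- colour is missing on the neighbours u, w, x of v, v receives it.
-- Otherwise u, w, x are coloured 1, 2, 3 in some order, and small degrees
-- force a local recolouring: a vertex with few neighbours can always drop
-- to a colour absent from its neighbourhood, and when both u and w are
-- saturated they swap their defective colours.

open import Defs
open import Data.Nat using (ℕ; suc; _≤_; z≤n; s≤s)
open import Data.Nat.Properties using (≤-trans; ≤-reflexive; ≤-pred; 1+n≰n; ≰⇒>; _≤?_)
open import Data.Bool using (Bool; true; false; not; _∨_; if_then_else_)
import Data.Bool.Properties as Bool
open import Data.Fin using (Fin) renaming (zero to fz; suc to fs)
open import Data.Fin.Properties using (_≟_; any?)
open import Data.List using (List; []; _∷_; _++_; length)
open import Data.List.Properties using (length-++-sucʳ)
open import Data.List.Relation.Unary.All as All using (All; []; _∷_)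
open import Data.List.Relation.Unary.AllPairs using ([]; _∷_)
open import Data.List.Relation.Unary.Any using (here; there)
open import Data.List.Relation.Unary.Unique.Propositional using (Unique)
open import Data.List.Membership.Propositional using (_∈_)
open import Data.List.Membership.Propositional.Properties
  using (∈-∃++; ∈-++⁻; ∈-++⁺ˡ; ∈-++⁺ʳ; ∈-filter⁺; ∈-allFin)
open import Data.Product using (Σ; _×_; _,_; proj₁; proj₂)
open import Data.Sum using (_⊎_; inj₁; inj₂)
open import Data.Empty using (⊥; ⊥-elim)
open import Function using (_∘_)
open import Function.Bundles using (Equivalence)
open import Relation.Binary.PropositionalEquality using (_≡_; _≢_; refl; sym; trans; cong; subst; ≢-sym)
open import Relation.Nullary using (¬_; Dec; yes; no)
open import Relation.Nullary.Decidable using (T?; _×-dec_; toSum)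

Graph : ℕ → Set
Graph n = Fin n → Fin n → Bool

Symmetric : ∀ {n} → Graph n → Set
Symmetric E = ∀ p q → E p q ≡ E q p

Loopless : ∀ {n} → Graph n → Set
Loopless E = ∀ p → E p p ≡ false

adjacent⇒distinct : ∀ {n} {E : Graph n} → Loopless E → ∀ {p q} → E p q ≡ true → p ≢ q
adjacent⇒distinct loopless {p} pq refl with trans (sym (loopless p)) pq
... | ()

unique⊆⇒length≤ : ∀ {A : Set} (ds L : List A) → Unique ds → (∀ {b} → b ∈ ds → b ∈ L) →
  length ds ≤ length L
unique⊆⇒length≤ [] L _ _ = z≤n
unique⊆⇒length≤ (d ∷ ds) L (d∉ds ∷ ds-unique) ds⊆L with ∈-∃++ (ds⊆L (here refl))
... | ys , zs , refl =
  subst (suc (length ds) ≤_) (sym (length-++-sucʳ ys d zs))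
    (s≤s (unique⊆⇒length≤ ds (ys ++ zs) ds-unique ds⊆ys++zs))
  where
  ds⊆ys++zs : ∀ {b} → b ∈ ds → b ∈ ys ++ zs
  ds⊆ys++zs b∈ds with ∈-++⁻ ys (ds⊆L (there b∈ds))
  ... | inj₁ b∈ys = ∈-++⁺ˡ b∈ys
  ... | inj₂ (here refl) = ⊥-elim (All.lookup d∉ds b∈ds refl)
  ... | inj₂ (there b∈zs) = ∈-++⁺ʳ ys b∈zs

neighbours≤degree : ∀ {n} (E : Graph n) a (ds : List (Fin n)) → Unique ds →
  All (λ b → E a b ≡ true) ds → length ds ≤ degree E a
neighbours≤degree E a ds unique adjacent = unique⊆⇒length≤ ds _ unique
  (λ b∈ds → ∈-filter⁺ (T? ∘ E a) (∈-allFin _)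
    (Equivalence.from Bool.T-≡ (All.lookup adjacent b∈ds)))

crowded : ∀ {n} (E : Graph n) {a d} (ds : List (Fin n)) → degree E a ≤ d →
  Unique ds → All (λ b → E a b ≡ true) ds → length ds ≡ suc d → ⊥
crowded E {a} {d} ds deg unique adjacent len =
  1+n≰n (subst (_≤ d) len (≤-trans (neighbours≤degree E a ds unique adjacent) deg))

if-both : ∀ {A : Set} (P : A → Set) b {x y : A} → P x → P y → P (if b then x else y)
if-both P true px py = px
if-both P false px py = py

SuccessorIn : ∀ {n} → List (Fin n) → Fin n → Fin n → Set
SuccessorIn l a r = r ≡ a ⊎ r ∈ l

-- nextIn is computed by a local helper of Defs that cannot be reasoned
-- about inductively, so its lists are inspected up to length four, which
-- covers the vertices of degree ≤ 4 used below.
nextIn-short : ∀ {n} (l : List (Fin n)) a → length l ≤ 4 → SuccessorIn l a (nextIn l a)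
nextIn-short [] a _ = inj₁ refl
nextIn-short (p ∷ []) a _ =
  if-both (SuccessorIn (p ∷ []) a) (p == a) (inj₂ (here refl)) (inj₁ refl)
nextIn-short {n} (p ∷ q ∷ []) a _ =
  if-both Ok (p == a) (inj₂ (there (here refl))) (
  if-both Ok (q == a) (inj₂ (here refl)) (inj₁ refl))
  where
  Ok : Fin n → Set
  Ok = SuccessorIn (p ∷ q ∷ []) a
nextIn-short {n} (p ∷ q ∷ r ∷ []) a _ =
  if-both Ok (p == a) (inj₂ (there (here refl))) (
  if-both Ok (q == a) (inj₂ (there (there (here refl)))) (
  if-both Ok (r == a) (inj₂ (here refl)) (inj₁ refl)))
  where
  Ok : Fin n → Set
  Ok = SuccessorIn (p ∷ q ∷ r ∷ []) a
nextIn-short {n} (p ∷ q ∷ r ∷ s ∷ []) a _ =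
  if-both Ok (p == a) (inj₂ (there (here refl))) (
  if-both Ok (q == a) (inj₂ (there (there (here refl)))) (
  if-both Ok (r == a) (inj₂ (there (there (there (here refl))))) (
  if-both Ok (s == a) (inj₂ (here refl)) (inj₁ refl))))
  where
  Ok : Fin n → Set
  Ok = SuccessorIn (p ∷ q ∷ r ∷ s ∷ []) a
nextIn-short (_ ∷ _ ∷ _ ∷ _ ∷ _ ∷ _) a (s≤s (s≤s (s≤s (s≤s ()))))

module _ (G : PlaneGraph) where
  open PlaneGraph G using (adj; irrefl; rot; rot-unique; rot-complete)

  rot-length : ∀ a → length (rot a) ≤ degree adj a
  rot-length a = neighbours≤degree adj a (rot a) (rot-unique a)
    (All.tabulate (Equivalence.to (rot-complete a _)))

  rotation-successor : ∀ a b → degree adj a ≤ 4 → nextIn (rot a) b ≢ b → adj a (nextIn (rot a) b) ≡ true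
  rotation-successor a b deg moved with nextIn-short (rot a) b (≤-trans (rot-length a) deg)
  ... | inj₁ fixed = ⊥-elim (moved fixed)
  ... | inj₂ member = Equivalence.to (rot-complete a _) member

  triangle-edges : ∀ v u → IsTriangularFaceDart G v u →
    degree adj u ≤ 4 → degree adj (thirdVertex G v u) ≤ 4 →
    adj v (thirdVertex G v u) ≡ true × adj u (thirdVertex G v u) ≡ true
  triangle-edges v u (vu , closes) deg-u deg-w = vw , uw
    where
    w : Fin (PlaneGraph.n G)
    w = thirdVertex G v u
    -- the face walk (v , u) ↦ (u , w) ↦ (w , v) returns to v
    w-to-v : nextIn (rot w) u ≡ v
    w-to-v = cong proj₁ closes
    vw : adj v w ≡ true
    vw = trans (PlaneGraph.sym G v w)
      (subst (λ z → adj w z ≡ true) w-to-v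
        (rotation-successor w u deg-w (λ fixed → adjacent⇒distinct {E = adj} irrefl vu (trans (sym w-to-v) fixed))))
    uw : adj u w ≡ true
    uw = rotation-successor u v deg-u (adjacent⇒distinct {E = adj} irrefl vw ∘ sym)

-- Colours 1 and 2 are defective: a vertex of such a colour may have one
-- neighbour of its own colour.  Colour 3 must be proper.
Defective : Fin 3 → Set
Defective k = k ≡ col1 ⊎ k ≡ col2

defective≢col3 : ∀ {k} → Defective k → k ≢ col3
defective≢col3 (inj₁ refl) ()
defective≢col3 (inj₂ refl) ()

defective-or-col3 : ∀ k → Defective k ⊎ k ≡ col3
defective-or-col3 fz = inj₁ (inj₁ refl)
defective-or-col3 (fs fz) = inj₁ (inj₂ refl)
defective-or-col3 (fs (fs fz)) = inj₂ refl

not-col3⇒defective : ∀ {k} → k ≢ col3 → Defective k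
not-col3⇒defective {k} k≢3 with defective-or-col3 k
... | inj₁ dk = dk
... | inj₂ k≡3 = ⊥-elim (k≢3 k≡3)

otherDefective : ∀ {k} → Defective k → Σ (Fin 3) λ m → Defective m × k ≢ m
otherDefective (inj₁ refl) = col2 , inj₂ refl , λ ()
otherDefective (inj₂ refl) = col1 , inj₁ refl , λ ()

avoidTwo : (i j : Fin 3) → Σ (Fin 3) λ k → i ≢ k × j ≢ k
avoidTwo fz fz = col2 , (λ ()) , (λ ())
avoidTwo fz (fs fz) = col3 , (λ ()) , (λ ())
avoidTwo fz (fs (fs fz)) = col2 , (λ ()) , (λ ())
avoidTwo (fs fz) fz = col3 , (λ ()) , (λ ())
avoidTwo (fs fz) (fs fz) = col1 , (λ ()) , (λ ())
avoidTwo (fs fz) (fs (fs fz)) = col1 , (λ ()) , (λ ())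
avoidTwo (fs (fs fz)) fz = col2 , (λ ()) , (λ ())
avoidTwo (fs (fs fz)) (fs fz) = col1 , (λ ()) , (λ ())
avoidTwo (fs (fs fz)) (fs (fs fz)) = col1 , (λ ()) , (λ ())

missingOrDistinct : (i j l : Fin 3) →
  (Σ (Fin 3) λ k → i ≢ k × j ≢ k × l ≢ k) ⊎ (i ≢ j × i ≢ l × j ≢ l)
missingOrDistinct i j l with i ≟ j | i ≟ l | j ≟ l
... | yes refl | _ | _ = let (k , i≢k , l≢k) = avoidTwo i l in inj₁ (k , i≢k , i≢k , l≢k)
... | no _ | yes refl | _ = let (k , i≢k , j≢k) = avoidTwo i j in inj₁ (k , i≢k , j≢k , i≢k)
... | no _ | no _ | yes refl = let (k , i≢k , j≢k) = avoidTwo i j in inj₁ (k , i≢k , j≢k , j≢k)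
... | no i≢j | no i≢l | no j≢l = inj₂ (i≢j , i≢l , j≢l)

colours-distinct : ∀ {n} (c : Fin n → Fin 3) {p q i j} → c p ≡ i → c q ≡ j → i ≢ j → p ≢ q
colours-distinct c cp cq i≢j refl = i≢j (trans (sym cp) cq)

module _ {n : ℕ} where

  ==-refl : ∀ (a : Fin n) → (a == a) ≡ true
  ==-refl a with a ≟ a
  ... | yes _ = refl
  ... | no a≢a = ⊥-elim (a≢a refl)

  ==-≢ : ∀ {p a : Fin n} → p ≢ a → (p == a) ≡ false
  ==-≢ {p} {a} p≢a with p ≟ a
  ... | yes p≡a = ⊥-elim (p≢a p≡a)
  ... | no _ = refl

  recolour : (Fin n → Fin 3) → Fin n → Fin 3 → Fin n → Fin 3
  recolour c a j p = if p == a then j else c p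

  recolour-at : ∀ c a j → recolour c a j a ≡ j
  recolour-at c a j rewrite ==-refl a = refl

  recolour-off : ∀ c {a} j {p} → p ≢ a → recolour c a j p ≡ c p
  recolour-off c j p≢a rewrite ==-≢ p≢a = refl

  untouched : ∀ c {a j p k} → p ≢ a → c p ≢ k → recolour c a j p ≢ k
  untouched c {j = j} p≢a cp≢k e = cp≢k (trans (sym (recolour-off c j p≢a)) e)

  recoloured : ∀ c {a j k} → j ≢ k → recolour c a j a ≢ k
  recoloured c {a} {j} j≢k e = j≢k (trans (sym (recolour-at c a j)) e)

  _∖_ : Graph n → Fin n → Graph n
  (E ∖ a) p q = if p == a ∨ q == a then false else E p q

  ∖-agree : ∀ E {a p q} → p ≢ a → q ≢ a → (E ∖ a) p q ≡ E p q
  ∖-agree E p≢a q≢a rewrite ==-≢ p≢a | ==-≢ q≢a = refl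

  ∖-edge : ∀ E a p q → (E ∖ a) p q ≡ true → p ≢ a × q ≢ a × E p q ≡ true
  ∖-edge E a p q e with p ≟ a | q ≟ a
  ∖-edge E a p q () | yes _ | _
  ∖-edge E a p q () | no _ | yes _
  ... | no p≢a | no q≢a = p≢a , q≢a , e

  ∖-⊆ : ∀ E a p q → (E ∖ a) p q ≡ true → E p q ≡ true
  ∖-⊆ E a p q e = proj₂ (proj₂ (∖-edge E a p q e))

  ∖-symmetric : ∀ E a → Symmetric E → Symmetric (E ∖ a)
  ∖-symmetric E a E-sym p q with p ≟ a | q ≟ a
  ... | yes _ | yes _ = refl
  ... | yes _ | no _ = refl
  ... | no _ | yes _ = refl
  ... | no _ | no _ = E-sym p q

  ∖-loopless : ∀ E a → Loopless E → Loopless (E ∖ a)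
  ∖-loopless E a E-loopless p with p ≟ a
  ... | yes _ = refl
  ... | no _ = E-loopless p

  vertexDeleted : (E : Graph n) → Symmetric E → Fin n → Subgraph E
  vertexDeleted E E-sym a = record
    { S = λ p → not (p == a) ; E' = E ∖ a ; E'-sym = ∖-symmetric E a E-sym
    ; E'⊆E = ∖-⊆ E a ; E'-S = λ p q e → kept (proj₁ (∖-edge E a p q e)) }
    where
    kept : ∀ {p} → p ≢ a → not (p == a) ≡ true
    kept p≢a rewrite ==-≢ p≢a = refl

  vertexDeleted-proper : ∀ E E-sym a → IsProper (vertexDeleted E E-sym a)
  vertexDeleted-proper E E-sym a = inj₁ (a , cong not (==-refl a))

  restrict : ∀ {E E' : Graph n} {c} → (∀ p q → E' p q ≡ true → E p q ≡ true) →
    Is110Coloring E c → Is110Coloring E' c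
  restrict E'⊆E (defect , proper) =
    (λ p w₁ w₂ dp e₁ e₂ → defect p w₁ w₂ dp (E'⊆E _ _ e₁) (E'⊆E _ _ e₂)) ,
    (λ p q e → proper p q (E'⊆E _ _ e))

  HasNeighbourColoured : Graph n → (Fin n → Fin 3) → Fin n → Fin 3 → Set
  HasNeighbourColoured E c a k = Σ (Fin n) λ b → E a b ≡ true × c b ≡ k

  hasNeighbourColoured? : ∀ E c a k → Dec (HasNeighbourColoured E c a k)
  hasNeighbourColoured? E c a k = any? λ b → (E a b Bool.≟ true) ×-dec (c b ≟ k)

  module Extension {E : Graph n} {c : Fin n → Fin 3} {a : Fin n} {j : Fin 3}
    (E-sym : Symmetric E) (E-loopless : Loopless E) (valid : Is110Coloring (E ∖ a) c)
    (no-3-3 : j ≡ col3 → ¬ HasNeighbourColoured E c a col3)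
    (one-partner : Defective j → ∀ {b₁ b₂} → E a b₁ ≡ true → E a b₂ ≡ true →
      c b₁ ≡ j → c b₂ ≡ j → b₁ ≡ b₂)
    (partner-alone : Defective j → ∀ {b d} → E a b ≡ true → c b ≡ j →
      E b d ≡ true → d ≢ a → c d ≢ j)
    where

    c′ : Fin n → Fin 3
    c′ = recolour c a j

    off : ∀ {p} → p ≢ a → c′ p ≡ c p
    off = recolour-off c j

    inner : ∀ {p q} → p ≢ a → q ≢ a → E p q ≡ true → (E ∖ a) p q ≡ true
    inner p≢a q≢a e = trans (∖-agree E p≢a q≢a) e

    neighbour≢a : ∀ {q} → E a q ≡ true → q ≢ a
    neighbour≢a e = ≢-sym (adjacent⇒distinct {E = E} E-loopless e)

    defect-with-a : ∀ {p w} → p ≢ a → Defective (c′ p) → E p a ≡ true → c′ a ≡ c′ p →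
      E p w ≡ true → w ≢ a → c′ w ≡ c′ p → ⊥
    defect-with-a {p} {w} p≢a dp pa ka pw w≢a kw =
      partner-alone dj (trans (E-sym a p) pa) cp≡j pw w≢a cw≡j
      where
      cp≡j : c p ≡ j
      cp≡j = trans (sym (off p≢a)) (trans (sym ka) (recolour-at c a j))
      dj : Defective j
      dj = subst Defective (trans (off p≢a) cp≡j) dp
      cw≡j : c w ≡ j
      cw≡j = trans (sym (off w≢a)) (trans kw (trans (off p≢a) cp≡j))

    defect-ok : ∀ p w₁ w₂ → Defective (c′ p) → E p w₁ ≡ true → E p w₂ ≡ true →
      c′ w₁ ≡ c′ p → c′ w₂ ≡ c′ p → w₁ ≡ w₂
    defect-ok p w₁ w₂ dp e₁ e₂ k₁ k₂ with toSum (p ≟ a) | toSum (w₁ ≟ a) | toSum (w₂ ≟ a)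
    ... | inj₁ refl | _ | _ =
      one-partner (subst Defective (recolour-at c a j) dp) e₁ e₂ (coloured-j e₁ k₁) (coloured-j e₂ k₂)
      where
      coloured-j : ∀ {w} → E a w ≡ true → c′ w ≡ c′ a → c w ≡ j
      coloured-j e k = trans (sym (off (neighbour≢a e))) (trans k (recolour-at c a j))
    ... | inj₂ _ | inj₁ refl | inj₁ refl = refl
    ... | inj₂ p≢a | inj₁ refl | inj₂ w₂≢a = ⊥-elim (defect-with-a p≢a dp e₁ k₁ e₂ w₂≢a k₂)
    ... | inj₂ p≢a | inj₂ w₁≢a | inj₁ refl = ⊥-elim (defect-with-a p≢a dp e₂ k₂ e₁ w₁≢a k₁)
    ... | inj₂ p≢a | inj₂ w₁≢a | inj₂ w₂≢a =
      proj₁ valid p w₁ w₂ (subst Defective (off p≢a) dp) (inner p≢a w₁≢a e₁) (inner p≢a w₂≢a e₂)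
        (unchanged w₁≢a k₁) (unchanged w₂≢a k₂)
      where
      unchanged : ∀ {w} → w ≢ a → c′ w ≡ c′ p → c w ≡ c p
      unchanged w≢a k = trans (sym (off w≢a)) (trans k (off p≢a))

    proper-at-a : ∀ {q} → E a q ≡ true → c′ a ≡ col3 → c′ q ≡ col3 → ⊥
    proper-at-a e ka kq =
      no-3-3 (trans (sym (recolour-at c a j)) ka) (_ , e , trans (sym (off (neighbour≢a e))) kq)

    proper-ok : ∀ p q → E p q ≡ true → c′ p ≡ col3 → c′ q ≢ col3
    proper-ok p q e kp kq with toSum (p ≟ a) | toSum (q ≟ a)
    ... | inj₁ refl | _ = proper-at-a e kp kq
    ... | inj₂ _ | inj₁ refl = proper-at-a (trans (E-sym q p) e) kq kp
    ... | inj₂ p≢a | inj₂ q≢a =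
      proj₂ valid p q (inner p≢a q≢a e) (trans (sym (off p≢a)) kp) (trans (sym (off q≢a)) kq)

    extended : Is110Coloring E c′
    extended = defect-ok , proper-ok

  extendFresh : ∀ {E : Graph n} {c a j} → Symmetric E → Loopless E → Is110Coloring (E ∖ a) c →
    ¬ HasNeighbourColoured E c a j → Is110Coloring E (recolour c a j)
  extendFresh E-sym E-loopless valid free = Extension.extended E-sym E-loopless valid
    (λ { refl → free })
    (λ _ e₁ _ k₁ _ → ⊥-elim (free (_ , e₁ , k₁)))
    (λ _ e k _ _ _ → free (_ , e , k))

  extendPaired : ∀ {E : Graph n} {c a j} t → Symmetric E → Loopless E → Is110Coloring (E ∖ a) c →
    Defective j → (∀ {b} → E a b ≡ true → c b ≡ j → b ≡ t) →
    ¬ HasNeighbourColoured (E ∖ a) c t j → Is110Coloring E (recolour c a j)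
  extendPaired {E} {c} {a} {j} t E-sym E-loopless valid dj only-t t-free =
    Extension.extended E-sym E-loopless valid (λ j≡3 → ⊥-elim (defective≢col3 dj j≡3))
      (λ _ e₁ e₂ k₁ k₂ → trans (only-t e₁ k₁) (sym (only-t e₂ k₂))) partner-alone
    where
    partner-alone : Defective j → ∀ {b d} → E a b ≡ true → c b ≡ j → E b d ≡ true → d ≢ a → c d ≢ j
    partner-alone _ ab k bd d≢a kd with only-t ab k
    ... | refl = t-free (_ , trans (∖-agree E (≢-sym (adjacent⇒distinct {E = E} E-loopless ab)) d≢a) bd , kd)

  recolourFresh : ∀ {F : Graph n} {c a j} → Symmetric F → Loopless F → Is110Coloring F c →
    ¬ HasNeighbourColoured F c a j → Is110Coloring F (recolour c a j)
  recolourFresh {F} {a = a} F-sym F-loopless valid =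
    extendFresh F-sym F-loopless (restrict (∖-⊆ F a) valid)

module Reduction {n : ℕ} {adj : Graph n} (adj-sym : Symmetric adj) (adj-loopless : Loopless adj)
  {v u w x : Fin n} (vu : adj v u ≡ true) (vw : adj v w ≡ true) (vx : adj v x ≡ true)
  (uw : adj u w ≡ true) (x≢u : x ≢ u) (x≢w : x ≢ w)
  (deg-v : degree adj v ≤ 3) (deg-u : degree adj u ≤ 4)
  (deg-w : degree adj w ≤ 4) (deg-x : degree adj x ≤ 3)
  where

  Gv : Graph n
  Gv = adj ∖ v

  Gv-sym : Symmetric Gv
  Gv-sym = ∖-symmetric adj v adj-sym

  Gv-loopless : Loopless Gv
  Gv-loopless = ∖-loopless adj v adj-loopless

  distinct : ∀ {p q} → adj p q ≡ true → p ≢ q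
  distinct = adjacent⇒distinct {E = adj} adj-loopless

  Gv⊆G : ∀ {p q} → Gv p q ≡ true → adj p q ≡ true
  Gv⊆G = ∖-⊆ adj v _ _

  avoids-v : ∀ {p q} → Gv p q ≡ true → v ≢ q
  avoids-v e = ≢-sym (proj₁ (proj₂ (∖-edge adj v _ _ e)))

  u≢w : u ≢ w
  u≢w = distinct uw

  u≢x : u ≢ x
  u≢x = ≢-sym x≢u

  w≢u : w ≢ u
  w≢u = ≢-sym u≢w

  neighbour-of-v : ∀ {b} → adj v b ≡ true → b ≡ u ⊎ b ≡ w ⊎ b ≡ x
  neighbour-of-v {b} vb with toSum (b ≟ u) | toSum (b ≟ w) | toSum (b ≟ x)
  ... | inj₁ b≡u | _ | _ = inj₁ b≡u
  ... | inj₂ _ | inj₁ b≡w | _ = inj₂ (inj₁ b≡w)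
  ... | inj₂ _ | inj₂ _ | inj₁ b≡x = inj₂ (inj₂ b≡x)
  ... | inj₂ b≢u | inj₂ b≢w | inj₂ b≢x = ⊥-elim (crowded adj (u ∷ w ∷ x ∷ b ∷ []) deg-v
        ((u≢w ∷ u≢x ∷ ≢-sym b≢u ∷ []) ∷ (≢-sym x≢w ∷ ≢-sym b≢w ∷ []) ∷ (≢-sym b≢x ∷ []) ∷ [] ∷ [])
        (vu ∷ vw ∷ vx ∷ vb ∷ []) refl)

  colourV-avoiding : ∀ c → Is110Coloring Gv c → ∀ {k} → c u ≢ k → c w ≢ k → c x ≢ k →
    Has110Coloring adj
  colourV-avoiding c valid {k} cu cw cx = recolour c v k , extendFresh adj-sym adj-loopless valid absent
    where
    absent : ¬ HasNeighbourColoured adj c v k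
    absent (b , vb , cb) with neighbour-of-v vb
    ... | inj₁ refl = cu cb
    ... | inj₂ (inj₁ refl) = cw cb
    ... | inj₂ (inj₂ refl) = cx cb

  colourV-paired : ∀ c → Is110Coloring Gv c → ∀ {k} t → Defective k →
    (∀ {b} → b ≡ u ⊎ b ≡ w ⊎ b ≡ x → c b ≡ k → b ≡ t) →
    ¬ HasNeighbourColoured Gv c t k → Has110Coloring adj
  colourV-paired c valid {k} t dk only-t t-free =
    recolour c v k ,
    extendPaired t adj-sym adj-loopless valid dk (only-t ∘ neighbour-of-v) t-free

  x-defective : ∀ c → Is110Coloring Gv c → ∀ {k m} → Defective k → Defective m → k ≢ m →
    c x ≡ k → c u ≢ k → c w ≢ k → Has110Coloring adj
  x-defective c valid {k} {m} dk dm k≢m cx cu cw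
    with hasNeighbourColoured? Gv c x k | hasNeighbourColoured? Gv c x col3
  ... | no x-free | _ = colourV-paired c valid x dk only-x x-free
    where
    only-x : ∀ {b} → b ≡ u ⊎ b ≡ w ⊎ b ≡ x → c b ≡ k → b ≡ x
    only-x (inj₁ refl) cb = ⊥-elim (cu cb)
    only-x (inj₂ (inj₁ refl)) cb = ⊥-elim (cw cb)
    only-x (inj₂ (inj₂ b≡x)) _ = b≡x
  ... | yes _ | no x-no-3 =
    colourV-avoiding (recolour c x col3) (recolourFresh Gv-sym Gv-loopless valid x-no-3)
      (untouched c u≢x cu) (untouched c (≢-sym x≢w) cw) (recoloured c (≢-sym (defective≢col3 dk)))
  ... | yes (y , xy , cy) | yes (z , xz , cz) =
    colourV-avoiding (recolour c x m) (recolourFresh Gv-sym Gv-loopless valid x-no-m)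
      (untouched c u≢x cu) (untouched c (≢-sym x≢w) cw) (recoloured c (≢-sym k≢m))
    where
    -- x already sees v, y (colour k) and z (colour 3), so has no room for colour m
    x-no-m : ¬ HasNeighbourColoured Gv c x m
    x-no-m (b , xb , cb) = crowded adj (v ∷ y ∷ z ∷ b ∷ []) deg-x
      ((avoids-v xy ∷ avoids-v xz ∷ avoids-v xb ∷ []) ∷
       (colours-distinct c cy cz (defective≢col3 dk) ∷ colours-distinct c cy cb k≢m ∷ []) ∷
       (colours-distinct c cz cb (≢-sym (defective≢col3 dm)) ∷ []) ∷ [] ∷ [])
      (trans (adj-sym x v) vx ∷ Gv⊆G xy ∷ Gv⊆G xz ∷ Gv⊆G xb ∷ []) refl

  -- Having degree ≤ 4, u and w exchange their colours
  -- (u first, in G − v − w), after which v takes colour k next to w alone.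
  swap-u-w : ∀ c → Is110Coloring Gv c → ∀ {k m} → Defective k → Defective m → k ≢ m →
    c u ≡ k → c w ≡ m → c x ≡ col3 →
    HasNeighbourColoured Gv c u k → HasNeighbourColoured Gv c u col3 →
    HasNeighbourColoured Gv c w m → HasNeighbourColoured Gv c w col3 → Has110Coloring adj
  swap-u-w c valid {k} {m} dk dm k≢m cu cw cx
    (d₁ , ud₁ , cd₁) (d₂ , ud₂ , cd₂) (e₁ , we₁ , ce₁) (e₂ , we₂ , ce₂) =
    colourV-paired c₂ valid₂ w dk only-w w-free
    where
    k≢3 : k ≢ col3
    k≢3 = defective≢col3 dk
    m≢3 : m ≢ col3
    m≢3 = defective≢col3 dm

    -- in G − v − w, u sees only d₁ (colour k) and d₂ (colour 3)
    u-no-m : ¬ HasNeighbourColoured (Gv ∖ w) c u m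
    u-no-m (b , ub , cb) = crowded adj (v ∷ w ∷ d₁ ∷ d₂ ∷ b ∷ []) deg-u
      ((distinct vw ∷ avoids-v ud₁ ∷ avoids-v ud₂ ∷ avoids-v ub′ ∷ []) ∷
       (colours-distinct c cw cd₁ (≢-sym k≢m) ∷ colours-distinct c cw cd₂ m≢3 ∷
        ≢-sym (proj₁ (proj₂ (∖-edge Gv w u b ub))) ∷ []) ∷
       (colours-distinct c cd₁ cd₂ k≢3 ∷ colours-distinct c cd₁ cb k≢m ∷ []) ∷
       (colours-distinct c cd₂ cb (≢-sym m≢3) ∷ []) ∷ [] ∷ [])
      (trans (adj-sym u v) vu ∷ uw ∷ Gv⊆G ud₁ ∷ Gv⊆G ud₂ ∷ Gv⊆G ub′ ∷ []) refl
      where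
      ub′ : Gv u b ≡ true
      ub′ = ∖-⊆ Gv w u b ub

    c₁ : Fin n → Fin 3
    c₁ = recolour c u m

    valid₁ : Is110Coloring (Gv ∖ w) c₁
    valid₁ = recolourFresh (∖-symmetric Gv w Gv-sym) (∖-loopless Gv w Gv-loopless)
      (restrict (∖-⊆ Gv w) valid) u-no-m

    -- in G − v, w now sees u (colour m), e₁ (colour m) and e₂ (colour 3)
    w-no-k : ¬ HasNeighbourColoured Gv c₁ w k
    w-no-k (b , wb , cb) with toSum (b ≟ u)
    ... | inj₁ refl = k≢m (trans (sym cb) (recolour-at c u m))
    ... | inj₂ b≢u = crowded adj (v ∷ u ∷ e₁ ∷ e₂ ∷ b ∷ []) deg-w
      ((distinct vu ∷ avoids-v we₁ ∷ avoids-v we₂ ∷ avoids-v wb ∷ []) ∷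
       (colours-distinct c cu ce₁ k≢m ∷ colours-distinct c cu ce₂ k≢3 ∷ ≢-sym b≢u ∷ []) ∷
       (colours-distinct c ce₁ ce₂ m≢3 ∷ colours-distinct c ce₁ cb′ (≢-sym k≢m) ∷ []) ∷
       (colours-distinct c ce₂ cb′ (≢-sym k≢3) ∷ []) ∷ [] ∷ [])
      (trans (adj-sym w v) vw ∷ trans (adj-sym w u) uw ∷ Gv⊆G we₁ ∷ Gv⊆G we₂ ∷ Gv⊆G wb ∷ []) refl
      where
      cb′ : c b ≡ k
      cb′ = trans (sym (recolour-off c m b≢u)) cb

    c₂ : Fin n → Fin 3
    c₂ = recolour c₁ w k

    valid₂ : Is110Coloring Gv c₂
    valid₂ = extendFresh Gv-sym Gv-loopless valid₁ w-no-k

    only-w : ∀ {b} → b ≡ u ⊎ b ≡ w ⊎ b ≡ x → c₂ b ≡ k → b ≡ w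
    only-w (inj₁ refl) cb =
      ⊥-elim (k≢m (trans (sym cb) (trans (recolour-off c₁ k u≢w) (recolour-at c u m))))
    only-w (inj₂ (inj₁ b≡w)) _ = b≡w
    only-w (inj₂ (inj₂ refl)) cb =
      ⊥-elim (k≢3 (trans (sym cb) (trans (recolour-off c₁ k x≢w) (trans (recolour-off c m x≢u) cx))))

    w-free : ¬ HasNeighbourColoured Gv c₂ w k
    w-free (b , wb , cb) =
      w-no-k (b , wb , trans (sym (recolour-off c₁ k (≢-sym (distinct (Gv⊆G wb))))) cb)

  x-col3 : ∀ c → Is110Coloring Gv c → ∀ {k m} → Defective k → Defective m → k ≢ m →
    c u ≡ k → c w ≡ m → c x ≡ col3 → Has110Coloring adj
  x-col3 c valid {k} {m} dk dm k≢m cu cw cx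
    with hasNeighbourColoured? Gv c u k | hasNeighbourColoured? Gv c w m
       | hasNeighbourColoured? Gv c u col3 | hasNeighbourColoured? Gv c w col3
  ... | no u-free | _ | _ | _ = colourV-paired c valid u dk only-u u-free
    where
    only-u : ∀ {b} → b ≡ u ⊎ b ≡ w ⊎ b ≡ x → c b ≡ k → b ≡ u
    only-u (inj₁ b≡u) _ = b≡u
    only-u (inj₂ (inj₁ refl)) cb = ⊥-elim (k≢m (trans (sym cb) cw))
    only-u (inj₂ (inj₂ refl)) cb = ⊥-elim (defective≢col3 dk (trans (sym cb) cx))
  ... | yes _ | no w-free | _ | _ = colourV-paired c valid w dm only-w w-free
    where
    only-w : ∀ {b} → b ≡ u ⊎ b ≡ w ⊎ b ≡ x → c b ≡ m → b ≡ w
    only-w (inj₁ refl) cb = ⊥-elim (k≢m (trans (sym cu) cb))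
    only-w (inj₂ (inj₁ b≡w)) _ = b≡w
    only-w (inj₂ (inj₂ refl)) cb = ⊥-elim (defective≢col3 dm (trans (sym cb) cx))
  ... | yes _ | yes _ | no u-no-3 | _ =
    colourV-avoiding (recolour c u col3) (recolourFresh Gv-sym Gv-loopless valid u-no-3)
      (recoloured c (≢-sym (defective≢col3 dk)))
      (untouched c w≢u (λ e → k≢m (trans (sym e) cw)))
      (untouched c x≢u (λ e → defective≢col3 dk (trans (sym e) cx)))
  ... | yes _ | yes _ | yes _ | no w-no-3 =
    colourV-avoiding (recolour c w col3) (recolourFresh Gv-sym Gv-loopless valid w-no-3)
      (untouched c u≢w (λ e → k≢m (trans (sym cu) e)))
      (recoloured c (≢-sym (defective≢col3 dm)))
      (untouched c x≢w (λ e → defective≢col3 dm (trans (sym e) cx)))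
  ... | yes u-k | yes w-m | yes u-3 | yes w-3 =
    swap-u-w c valid dk dm k≢m cu cw cx u-k u-3 w-m w-3

  extend-over-v : Has110Coloring Gv → Has110Coloring adj
  extend-over-v (c , valid) with missingOrDistinct (c u) (c w) (c x)
  ... | inj₁ (_ , cu , cw , cx) = colourV-avoiding c valid cu cw cx
  ... | inj₂ (cu≢cw , cu≢cx , cw≢cx) with defective-or-col3 (c x)
  ...   | inj₁ dx = let (_ , dm , k≢m) = otherDefective dx in
    x-defective c valid dx dm k≢m refl cu≢cx cw≢cx
  ...   | inj₂ cx≡3 = x-col3 c valid (defective-besides cu≢cx) (defective-besides cw≢cx) cu≢cw refl refl cx≡3
    where
    defective-besides : ∀ {i} → i ≢ c x → Defective i
    defective-besides i≢cx = not-col3⇒defective (λ i≡3 → i≢cx (trans i≡3 (sym cx≡3)))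

lemma2p5 : (G : PlaneGraph) → MinimalCounterexample G →
    ∀ v u → IsTriangularFaceDart G v u →
    degree (PlaneGraph.adj G) v ≡ 3 →
    degree (PlaneGraph.adj G) u ≡ 4 →
    degree (PlaneGraph.adj G) (thirdVertex G v u) ≡ 4 →
    ∀ x → PlaneGraph.adj G v x ≡ true → x ≢ u → x ≢ thirdVertex G v u →
    4 ≤ degree (PlaneGraph.adj G) x
lemma2p5 G M v u face deg-v deg-u deg-w x vx x≢u x≢w with 4 ≤? degree (PlaneGraph.adj G) x
... | yes deg-x≥4 = deg-x≥4
... | no deg-x≱4 = ⊥-elim (not-colorable (extend-over-v
      (proper-colorable (vertexDeleted adj adj-sym v) (vertexDeleted-proper adj adj-sym v))))
  where
  open PlaneGraph G using (adj; irrefl) renaming (sym to adj-sym)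
  open MinimalCounterexample M using (not-colorable; proper-colorable)
  edges : adj v (thirdVertex G v u) ≡ true × adj u (thirdVertex G v u) ≡ true
  edges = triangle-edges G v u face (≤-reflexive deg-u) (≤-reflexive deg-w)
  open Reduction adj-sym irrefl (proj₁ face) (proj₁ edges) vx (proj₂ edges) x≢u x≢w
    (≤-reflexive deg-v) (≤-reflexive deg-u) (≤-reflexive deg-w) (≤-pred (≰⇒> deg-x≱4))
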